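{- Let $G$ be a finite simple graph with vertex set $\{v_1,\dots,v_n\}$ where vertex $v_i$ has positive integer weight $t_i$. Let $G(v_1,\dots,v_n)$ be the unweighted graph obtained by replacing each $v_i$ by an independent set of $t_i$ new vertices, each adjacent to exactly the new vertices that replace the neighbours of $v_i$ in $G$ (so two new vertices are adjacent iff they replace adjacent vertices of $G$). Then weighted Grim on $G$ and (ordinary) Grim on $G(v_1,\dots,v_n)$ have the same outcome: one is an $\mathcal{N}$ position if and only if the other is.
   Context: Weighted Grim: two players alternate moves on a finite simple undirected graph whose vertices carry positive integer weights. A move consists of selecting a remaining vertex. A vertex of weight $t$ is deleted (together with all its incident edges) once it has been selected $t$ times; in addition, whenever a vertex becomes isolated it is deleted immediately (isolated vertices are also deleted before play starts). The player who makes the last legal move wins; a player with no available move loses. Ordinary Grim is the case where all weights are $1$: a move deletes a chosen vertex and its incident edges, and then deletes all vertices that became isolated. A position is an $\mathcal{N}$ position if the player about to move has a winning strategy, and a $\mathcal{P}$ position otherwise. -}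

module Defs where

open import Data.Nat using (ℕ; zero; suc; pred; _<_; _≤_)
open import Data.Fin as Fin using (Fin)
open import Data.Bool using (Bool; true; false; T; if_then_else_)
open import Data.Product using (Σ; _×_; _,_)
open import Data.Product.Properties using (≡-dec)
open import Data.Sum using (_⊎_)
open import Relation.Nullary using (¬_; does)
open import Relation.Binary.PropositionalEquality using (_≡_)
open import Relation.Binary.Definitions using (DecidableEquality)

record SimpleGraph : Set where
  field
    n     : ℕ
    adj   : Fin n → Fin n → Bool
    sym   : ∀ i j → adj i j ≡ adj j i
    irrefl : ∀ i → adj i i ≡ false

-- A position is a function r : V → ℕ giving for each vertex the number
-- of selections still needed to delete it; r v ≡ 0 means v is deleted.
-- (Ordinary Grim is the case where all initial weights are 1.)

module Grim {V : Set} (_≟_ : DecidableEquality V) (E : V → V → Set) where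

  HasNbr : (V → ℕ) → V → Set
  HasNbr r v = Σ V λ u → E v u × 0 < r u

  Cleaned : (V → ℕ) → (V → ℕ) → Set
  Cleaned r r' = ∀ v → (HasNbr r v × r' v ≡ r v) ⊎ (¬ HasNbr r v × r' v ≡ 0)

  select : (V → ℕ) → V → (V → ℕ)
  select r v u = if does (u ≟ v) then pred (r u) else r u

  Move : (V → ℕ) → (V → ℕ) → Set
  Move r r' = Σ V λ v → 0 < r v × Cleaned (select r v) r'

  mutual
    data NPos (r : V → ℕ) : Set where
      toP : ∀ r' → Move r r' → PPos r' → NPos r

    data PPos (r : V → ℕ) : Set where
      allN : (∀ r' → Move r r' → NPos r') → PPos r

  WeightedGrimN : (V → ℕ) → Set
  WeightedGrimN t = ∀ r → Cleaned t r → NPos r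

  GrimN : Set
  GrimN = WeightedGrimN (λ _ → 1)

module _ (G : SimpleGraph) where
  open SimpleGraph G

  Adj : Fin n → Fin n → Set
  Adj i j = T (adj i j)

  BlowVertex : (Fin n → ℕ) → Set
  BlowVertex t = Σ (Fin n) λ i → Fin (t i)

  BlowAdj : (t : Fin n → ℕ) → BlowVertex t → BlowVertex t → Set
  BlowAdj t (i , _) (j , _) = T (adj i j)

  blow-≟ : (t : Fin n → ℕ) → DecidableEquality (BlowVertex t)
  blow-≟ t = ≡-dec Fin._≟_ Fin._≟_

  WeightedGrimOnN : (Fin n → ℕ) → Set
  WeightedGrimOnN t = Grim.WeightedGrimN Fin._≟_ Adj t

  BlowUpGrimN : (Fin n → ℕ) → Set
  BlowUpGrimN t = Grim.GrimN (blow-≟ t) (BlowAdj t)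

-- Selecting a vertex of weight t in weighted Grim corresponds to selecting one of its t copies
-- in the blow-up. Relate a blow-up position b to the weighted position w whose entry at i is the
-- number of selections still available on the copies of i, i.e. the sum of b over them. A copy
-- has a present neighbour exactly when its original has one, so isolated-vertex deletion
-- commutes with this summation, and selecting a copy of i lowers the sum at i by one. Hence
-- every move of either game is answered by a move of the other to a related position, and
-- related positions have the same outcome.
module Submission where

open import Defs
open import Data.Nat using (ℕ; zero; suc; pred; _+_; _≤_; _<_; _<?_)
open import Data.Nat.Properties
  using (+-0-commutativeMonoid; <-≤-trans; m≤m+n; +-∸-comm; ≮⇒≥; n≤0⇒n≡0; <-irrefl)
open import Algebra.Properties.CommutativeMonoid.Sum +-0-commutativeMonoid
  using (sum; sum-cong-≗; sum-replicate-zero; sum-remove)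
open import Data.Fin as Fin using (Fin; punchIn)
open import Data.Fin.Properties using (any?; punchInᵢ≢i)
open import Data.Vec.Functional using (Vector; removeAt)
open import Data.Bool.Properties using (T?)
open import Data.Product using (_×_; ∃; _,_; proj₁)
open import Data.Sum using (inj₁; inj₂)
open import Function using (_∘_; flip)
open import Relation.Nullary using (¬_; Dec; yes; no; _×-dec_; contradiction)
open import Relation.Nullary.Decidable using (map′)
open import Relation.Binary.Definitions using (DecidableEquality)
open import Relation.Binary.PropositionalEquality
  using (_≡_; _≢_; refl; sym; trans; cong; cong₂; subst; module ≡-Reasoning)

open ≡-Reasoning

0<f⇒0<sum : ∀ {m} (f : Vector ℕ m) {c} → 0 < f c → 0 < sum f
0<f⇒0<sum {suc m} f {c} 0<fc =
  subst (0 <_) (sym (sum-remove {i = c} f)) (<-≤-trans 0<fc (m≤m+n (f c) _))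

sum-zeros : ∀ {m} {f : Vector ℕ m} → (∀ c → f c ≡ 0) → sum f ≡ 0
sum-zeros {m} f≗0 = trans (sum-cong-≗ f≗0) (sum-replicate-zero m)

0<sum⇒0<f : ∀ {m} (f : Vector ℕ m) → 0 < sum f → ∃ λ c → 0 < f c
0<sum⇒0<f f 0<sum with any? (λ c → 0 <? f c)
... | yes found = found
... | no none = contradiction (subst (0 <_) (sum-zeros f≗0) 0<sum) (<-irrefl refl)
  where
  f≗0 : ∀ c → f c ≡ 0
  f≗0 c = n≤0⇒n≡0 (≮⇒≥ (none ∘ (c ,_)))

sum-ones : ∀ m → sum {m} (λ _ → 1) ≡ m
sum-ones zero    = refl
sum-ones (suc m) = cong suc (sum-ones m)

sum-pred : ∀ {m} {f g : Vector ℕ m} {a} → 0 < f a →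
           g a ≡ pred (f a) → (∀ c → c ≢ a → g c ≡ f c) → sum g ≡ pred (sum f)
sum-pred {suc m} {f} {g} {a} 0<fa ga≡ g≗f = begin
  sum g                              ≡⟨ sum-remove g ⟩
  g a + sum (removeAt g a)           ≡⟨ cong₂ _+_ ga≡ (sum-cong-≗ (λ c →
                                          g≗f (punchIn a c) (punchInᵢ≢i a c))) ⟩
  pred (f a) + sum (removeAt f a)    ≡⟨ sym (+-∸-comm _ 0<fa) ⟩
  pred (f a + sum (removeAt f a))    ≡⟨ cong pred (sym (sum-remove f)) ⟩
  pred (sum f)                       ∎

module GrimProperties {V : Set} (_≟_ : DecidableEquality V) (E : V → V → Set) where
  open Grim _≟_ E public

  select-≡ : ∀ {r v} → select r v v ≡ pred (r v)
  select-≡ {r} {v} with v ≟ v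
  ... | yes _   = refl
  ... | no v≢v = contradiction refl v≢v

  select-≢ : ∀ {r u v} → u ≢ v → select r v u ≡ r u
  select-≢ {r} {u} {v} u≢v with u ≟ v
  ... | yes u≡v = contradiction u≡v u≢v
  ... | no _    = refl

  cleaned-kept : ∀ {r r' v} → Cleaned r r' → HasNbr r v → r' v ≡ r v
  cleaned-kept {v = v} cl h with cl v
  ... | inj₁ (_ , e)  = e
  ... | inj₂ (¬h , _) = contradiction h ¬h

  cleaned-removed : ∀ {r r' v} → Cleaned r r' → ¬ HasNbr r v → r' v ≡ 0
  cleaned-removed {v = v} cl ¬h with cl v
  ... | inj₁ (h , _)  = contradiction h ¬h
  ... | inj₂ (_ , e)  = e

  cleaned-exists : (∀ r v → Dec (HasNbr r v)) → ∀ r → ∃ (Cleaned r)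
  cleaned-exists hasNbr? r = clean , cleaned
    where
    clean : V → ℕ
    clean v with hasNbr? r v
    ... | yes _ = r v
    ... | no _  = 0

    cleaned : Cleaned r clean
    cleaned v with hasNbr? r v
    ... | yes h = inj₁ (h , refl)
    ... | no ¬h = inj₂ (¬h , refl)

Simulation : {V₁ V₂ : Set} → DecidableEquality V₁ → (V₁ → V₁ → Set) →
             DecidableEquality V₂ → (V₂ → V₂ → Set) → ((V₁ → ℕ) → (V₂ → ℕ) → Set) → Set
Simulation _≟₁_ E₁ _≟₂_ E₂ _~_ = ∀ {r₁ r₂ r₁'} → r₁ ~ r₂ → Grim.Move _≟₁_ E₁ r₁ r₁' →
                                 ∃ λ r₂' → Grim.Move _≟₂_ E₂ r₂ r₂' × r₁' ~ r₂'

module _ {V₁ V₂ : Set} {_≟₁_ : DecidableEquality V₁} {E₁ : V₁ → V₁ → Set}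
                       {_≟₂_ : DecidableEquality V₂} {E₂ : V₂ → V₂ → Set}
         {_~_ : (V₁ → ℕ) → (V₂ → ℕ) → Set}
         (forth : Simulation _≟₁_ E₁ _≟₂_ E₂ _~_)
         (back : Simulation _≟₂_ E₂ _≟₁_ E₁ (flip _~_)) where
  private
    module G₁ = Grim _≟₁_ E₁
    module G₂ = Grim _≟₂_ E₂

  mutual
    NPos-transfer : ∀ {r₁ r₂} → r₁ ~ r₂ → G₁.NPos r₁ → G₂.NPos r₂
    NPos-transfer r₁~r₂ (G₁.toP r₁' move p) with forth r₁~r₂ move
    ... | r₂' , move' , r₁'~r₂' = G₂.toP r₂' move' (PPos-transfer r₁'~r₂' p)

    PPos-transfer : ∀ {r₁ r₂} → r₁ ~ r₂ → G₁.PPos r₁ → G₂.PPos r₂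
    PPos-transfer r₁~r₂ (G₁.allN answer) = G₂.allN λ r₂' move → answerFrom (back r₁~r₂ move)
      where
      answerFrom : ∀ {r₂'} → ∃ (λ r₁' → G₁.Move _ r₁' × r₁' ~ r₂') → G₂.NPos r₂'
      answerFrom (r₁' , move' , r₁'~r₂') = NPos-transfer r₁'~r₂' (answer r₁' move')

module BlowUp (G : SimpleGraph) (t : Fin (SimpleGraph.n G) → ℕ) where
  open SimpleGraph G using (n; adj)
  module W = GrimProperties Fin._≟_ (Adj G)
  module B = GrimProperties (blow-≟ G t) (BlowAdj G t)

  copySum : (BlowVertex G t → ℕ) → Fin n → ℕ
  copySum b i = sum λ c → b (i , c)

  copySum-cong : ∀ {b b' i} → (∀ c → b (i , c) ≡ b' (i , c)) → copySum b i ≡ copySum b' i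
  copySum-cong = sum-cong-≗

  Collapses : (BlowVertex G t → ℕ) → (Fin n → ℕ) → Set
  Collapses b w = ∀ i → w i ≡ copySum b i

  module _ {b w} (b↦w : Collapses b w) where
    0<w⇒0<b : ∀ {i} → 0 < w i → ∃ λ c → 0 < b (i , c)
    0<w⇒0<b {i} 0<wi = 0<sum⇒0<f (λ c → b (i , c)) (subst (0 <_) (b↦w i) 0<wi)

    0<b⇒0<w : ∀ {i c} → 0 < b (i , c) → 0 < w i
    0<b⇒0<w {i} {c} 0<bic = subst (0 <_) (sym (b↦w i)) (0<f⇒0<sum (λ c → b (i , c)) 0<bic)

    hasNbr⁺ : ∀ {i c} → W.HasNbr w i → B.HasNbr b (i , c)
    hasNbr⁺ (j , i~j , 0<wj) with 0<w⇒0<b 0<wj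
    ... | d , 0<bjd = (j , d) , i~j , 0<bjd

    hasNbr⁻ : ∀ {i c} → B.HasNbr b (i , c) → W.HasNbr w i
    hasNbr⁻ ((j , _) , i~j , 0<bjd) = j , i~j , 0<b⇒0<w 0<bjd

  hasNbrW? : ∀ w i → Dec (W.HasNbr w i)
  hasNbrW? w i = any? λ j → T? (adj i j) ×-dec (0 <? w j)

  hasNbrB? : ∀ b v → Dec (B.HasNbr b v)
  hasNbrB? b (i , c) =
    map′ (hasNbr⁺ b↦copySum {c = c}) (hasNbr⁻ b↦copySum {c = c}) (hasNbrW? (copySum b) i)
    where
    b↦copySum : Collapses b (copySum b)
    b↦copySum _ = refl

  cleaned-collapses : ∀ {b b' w w'} → Collapses b w → B.Cleaned b b' → W.Cleaned w w' →
                      Collapses b' w'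
  cleaned-collapses {b} {b'} {w} {w'} b↦w clB clW i with clW i
  ... | inj₁ (h , w'i≡) = begin
    w' i          ≡⟨ w'i≡ ⟩
    w i           ≡⟨ b↦w i ⟩
    copySum b i   ≡⟨ copySum-cong {b = b} {b'} (λ c →
                       sym (B.cleaned-kept clB (hasNbr⁺ b↦w {c = c} h))) ⟩
    copySum b' i  ∎
  ... | inj₂ (¬h , w'i≡0) =
    trans w'i≡0 (sym (sum-zeros λ c → B.cleaned-removed clB (¬h ∘ hasNbr⁻ b↦w {c = c})))

  select-collapses : ∀ {b w i a} → Collapses b w → 0 < b (i , a) →
                     Collapses (B.select b (i , a)) (W.select w i)
  select-collapses {b} {w} {i} {a} b↦w 0<bia j = at j (j Fin.≟ i)
    where
    at : ∀ j → Dec (j ≡ i) → W.select w i j ≡ copySum (B.select b (i , a)) j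
    at j (no j≢i) = begin
      W.select w i j                 ≡⟨ W.select-≢ {r = w} j≢i ⟩
      w j                            ≡⟨ b↦w j ⟩
      copySum b j                    ≡⟨ copySum-cong {b = b} {B.select b (i , a)} (λ c →
                                          sym (B.select-≢ {r = b} (j≢i ∘ cong proj₁))) ⟩
      copySum (B.select b (i , a)) j ∎
    at j (yes refl) = begin
      W.select w i i                 ≡⟨ W.select-≡ {r = w} ⟩
      pred (w i)                     ≡⟨ cong pred (b↦w i) ⟩
      pred (copySum b i)             ≡⟨ sym (sum-pred 0<bia (B.select-≡ {r = b}) selected-elsewhere) ⟩
      copySum (B.select b (i , a)) i ∎
      where
      selected-elsewhere : ∀ c → c ≢ a → B.select b (i , a) (i , c) ≡ b (i , c)
      selected-elsewhere c c≢a = B.select-≢ {r = b} {u = i , c} {v = i , a} λ { refl → c≢a refl }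

  blowUp-simulated : Simulation (blow-≟ G t) (BlowAdj G t) Fin._≟_ (Adj G) Collapses
  blowUp-simulated {r₂ = w} b↦w ((i , a) , 0<bia , clB) =
    let w' , clW = W.cleaned-exists hasNbrW? (W.select w i) in
    w' , (i , 0<b⇒0<w b↦w 0<bia , clW) ,
    cleaned-collapses (select-collapses b↦w 0<bia) clB clW

  weighted-simulated :
    Simulation Fin._≟_ (Adj G) (blow-≟ G t) (BlowAdj G t) (flip Collapses)
  weighted-simulated {r₂ = b} b↦w (i , 0<wi , clW) =
    let a , 0<bia = 0<w⇒0<b b↦w 0<wi
        b' , clB = B.cleaned-exists hasNbrB? (B.select b (i , a))
    in b' , ((i , a) , 0<bia , clB) , cleaned-collapses (select-collapses b↦w 0<bia) clB clW

  initial-collapses : ∀ {b w} → B.Cleaned (λ _ → 1) b → W.Cleaned t w → Collapses b w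
  initial-collapses = cleaned-collapses (λ i → sym (sum-ones (t i)))

theorem2p3 : (G : SimpleGraph) (t : Fin (SimpleGraph.n G) → ℕ) →
    (∀ i → 1 ≤ t i) →
    (WeightedGrimOnN G t → BlowUpGrimN G t) × (BlowUpGrimN G t → WeightedGrimOnN G t)
theorem2p3 G t _ = weighted⇒blowUp , blowUp⇒weighted
  where
  open BlowUp G t

  weighted⇒blowUp : WeightedGrimOnN G t → BlowUpGrimN G t
  weighted⇒blowUp weightedN b clB =
    let w , clW = W.cleaned-exists hasNbrW? t in
    NPos-transfer weighted-simulated blowUp-simulated (initial-collapses clB clW) (weightedN w clW)

  blowUp⇒weighted : BlowUpGrimN G t → WeightedGrimOnN G t
  blowUp⇒weighted blowUpN w clW =
    let b , clB = B.cleaned-exists hasNbrB? (λ _ → 1) in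
    NPos-transfer blowUp-simulated weighted-simulated (initial-collapses clB clW) (blowUpN b clB)
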